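{- Let $G$ and $H$ be graphs. Then \[ min_D(G\square H)\leq min_D(G)\,|V(H)|+min_D(H)\,|V(G)|-min_D(G)\,min_D(H).\]
   Context: All graphs are finite and simple. In the irreversible majority conversion process on a graph $G$, every vertex is black or white at each discrete time step $t=0,1,2,\ldots$. A black vertex stays black forever. A white vertex $v$ of degree $\deg_G(v)\geq 1$ becomes black at time $t$ if at least $\deg_G(v)/2$ of its neighbors are black at time $t-1$. An isolated vertex never changes color. A dynamo of $G$ is a set $D\subseteq V(G)$ such that, if exactly the vertices of $D$ are black at time $0$, then every vertex of $G$ is eventually black. $min_D(G)$ denotes the minimum size of a dynamo of $G$. The Cartesian product $G\square H$ has vertex set $V(G)\times V(H)$. In it, $(u,u')$ and $(v,v')$ are adjacent if and only if either $u=v$ and $u'v'\in E(H)$, or $u'=v'$ and $uv\in E(G)$. -}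

module Defs where

open import Data.Nat using (ℕ; zero; suc; _+_; _*_; _≤_; _≥_) renaming (_≤?_ to ≤?)
open import Data.Bool using (Bool; true; false; _∨_; _∧_; if_then_else_)
open import Data.Fin using (Fin; zero; suc; quotient; remainder; _≟_)
open import Data.Product using (Σ; _×_; _,_; ∃)
open import Relation.Nullary.Decidable using (⌊_⌋)
open import Relation.Binary.PropositionalEquality using (_≡_; refl; cong₂) renaming (sym to ≡sym)
open import Relation.Nullary using (yes; no)
open import Data.Empty using (⊥-elim)
open import Data.Bool.Properties using (∧-zeroʳ)

record Graph : Set where
  field
    n     : ℕ
    adj   : Fin n → Fin n → Bool
    sym   : ∀ u v → adj u v ≡ adj v u
    irrefl : ∀ v → adj v v ≡ false
open Graph public

∣V∣ : Graph → ℕ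
∣V∣ G = n G

count : ∀ {k} → (Fin k → Bool) → ℕ
count {zero}  P = 0
count {suc k} P = (if P zero then 1 else 0) + count (λ i → P (suc i))

-- a colouring / subset of vertices (true = black / member)
Colouring : Graph → Set
Colouring G = Fin (n G) → Bool

deg : (G : Graph) → Fin (n G) → ℕ
deg G v = count (adj G v)

blackNbrs : (G : Graph) → Colouring G → Fin (n G) → ℕ
blackNbrs G c v = count (λ w → adj G v w ∧ c w)

-- white v with deg v ≥ 1 turns black iff #black neighbours ≥ deg v / 2,
-- i.e. 2 * #black neighbours ≥ deg v.  Isolated vertices never change.
becomesBlack : (G : Graph) → Colouring G → Fin (n G) → Bool
becomesBlack G c v with deg G v
... | zero  = false
... | suc d = ⌊ ≤? (suc d) (2 * blackNbrs G c v) ⌋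

step : (G : Graph) → Colouring G → Colouring G
step G c v = c v ∨ becomesBlack G c v

process : (G : Graph) → Colouring G → ℕ → Colouring G
process G D zero    = D
process G D (suc t) = step G (process G D t)

IsDynamo : (G : Graph) → Colouring G → Set
IsDynamo G D = ∃ λ t → ∀ v → process G D t v ≡ true

size : (G : Graph) → Colouring G → ℕ
size G D = count D

IsMinDynamoSize : Graph → ℕ → Set
IsMinDynamoSize G k =
  (Σ (Colouring G) λ D → IsDynamo G D × size G D ≡ k)
  × (∀ D → IsDynamo G D → k ≤ size G D)

-- Cartesian product G □ H on Fin (n G * n H); index i encodes the pair
-- (quotient i, remainder i) (a bijection Fin (n*m) ≃ Fin n × Fin m).
_□_ : Graph → Graph → Graph
G □ H = record
  { n = n G * n H
  ; adj = padj
  ; sym = psym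
  ; irrefl = pirr
  }
  where
  fst : Fin (n G * n H) → Fin (n G)
  fst i = quotient (n H) i
  snd : Fin (n G * n H) → Fin (n H)
  snd i = remainder {n G} (n H) i
  eqb : ∀ {k} → Fin k → Fin k → Bool
  eqb a b = ⌊ a ≟ b ⌋
  padj : Fin (n G * n H) → Fin (n G * n H) → Bool
  padj i j = (eqb (fst i) (fst j) ∧ adj H (snd i) (snd j))
           ∨ (eqb (snd i) (snd j) ∧ adj G (fst i) (fst j))
  eqb-sym : ∀ {k} (a b : Fin k) → eqb a b ≡ eqb b a
  eqb-sym a b with a ≟ b | b ≟ a
  ... | yes _ | yes _ = refl
  ... | no _ | no _ = refl
  ... | yes p | no q = ⊥-elim (q (≡sym p))
  ... | no p | yes q = ⊥-elim (p (≡sym q))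
  psym : ∀ i j → padj i j ≡ padj j i
  psym i j = cong₂ _∨_ (cong₂ _∧_ (eqb-sym (fst i) (fst j)) (Graph.sym H (snd i) (snd j)))
                       (cong₂ _∧_ (eqb-sym (snd i) (snd j)) (Graph.sym G (fst i) (fst j)))
  pirr : ∀ i → padj i i ≡ false
  pirr i rewrite Graph.irrefl H (snd i) | Graph.irrefl G (fst i)
               | ∧-zeroʳ (eqb (fst i) (fst i)) | ∧-zeroʳ (eqb (snd i) (snd i)) = refl

-- Let DG, DH be dynamos of G and H and colour (g , h) black iff g ∈ DG or h ∈ DH; this set has
-- |DG| |V(H)| + |V(G)| |DH| − |DG| |DH| elements.  It is a dynamo of G □ H: if g is black at
-- time s in G and h is black at time r in H, then (g , h) is black at time s + r.  When both
-- turn black at the last step, the neighbours of (g , h) along its G-fibre and its H-fibre are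
-- black by induction, at least deg g / 2 + deg h / 2 = deg (g , h) / 2 of them.
module Submission where

open import Defs hiding (sym)
open import Algebra.Properties.CommutativeSemigroup using (interchange)
open import Data.Bool using (Bool; true; false; _∨_; _∧_; if_then_else_)
open import Data.Bool.Properties using (∧-assoc; ∧-identityʳ; ∧-zeroʳ; ∧-distribʳ-∨; ∨-zeroʳ)
open import Data.Empty using (⊥-elim)
open import Data.Fin using (Fin; zero; suc; combine; quotient; remainder; _↑ˡ_; _↑ʳ_; _≟_)
open import Data.Fin.Properties using (remQuot-combine; combine-remQuot)
open import Data.Nat using (ℕ; zero; suc; _+_; _*_; _∸_; _≤_; z≤n; s≤s) renaming (_≤?_ to ≤?)
open import Data.Nat.Properties
  using (≤-refl; ≤-reflexive; +-mono-≤; +-monoʳ-≤; *-monoʳ-≤; *-distribˡ-+; *-comm;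
         +-assoc; +-suc; m≤n+m; n≤1+n; m≤n⇒m<n∨m≡n; m+n∸n≡m; +-identityʳ; module ≤-Reasoning;
         +-commutativeSemigroup; +-*-semiring)
open import Algebra.Properties.Semiring.Sum +-*-semiring
  using (sum-syntax; ∑-distrib-+; sum-cong-≗; sum-replicate-zero)
open import Data.Product using (_×_; _,_; proj₁; proj₂; uncurry)
open import Data.Sum using (_⊎_; inj₁; inj₂)
open import Function using (_∘_)
open import Relation.Binary.PropositionalEquality
open import Relation.Nullary using (yes; no)
open import Relation.Nullary.Decidable using (⌊_⌋)

private
  variable
    k : ℕ

indicator : Bool → ℕ
indicator b = if b then 1 else 0

_⊆_ : (Fin k → Bool) → (Fin k → Bool) → Set
P ⊆ Q = ∀ i → P i ≡ true → Q i ≡ true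

count-cong : {P Q : Fin k → Bool} → P ≗ Q → count P ≡ count Q
count-cong {zero}  _   = refl
count-cong {suc k} P≗Q = cong₂ _+_ (cong indicator (P≗Q zero)) (count-cong (P≗Q ∘ suc))

count-mono : {P Q : Fin k → Bool} → P ⊆ Q → count P ≤ count Q
count-mono {zero}  _ = z≤n
count-mono {suc k} {P} {Q} P⊆Q =
  +-mono-≤ (indicator-mono (P zero) (Q zero) (P⊆Q zero)) (count-mono (P⊆Q ∘ suc))
  where
  indicator-mono : ∀ a b → (a ≡ true → b ≡ true) → indicator a ≤ indicator b
  indicator-mono false _     _   = z≤n
  indicator-mono true  true  _   = ≤-refl
  indicator-mono true  false a⇒b with () ← a⇒b refl

count-false : ∀ k → count {k} (λ _ → false) ≡ 0
count-false zero    = refl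
count-false (suc k) = count-false k

count-true : ∀ k → count {k} (λ _ → true) ≡ k
count-true zero    = refl
count-true (suc k) = cong suc (count-true k)

count-const-∧ : ∀ b (P : Fin k → Bool) → count (λ i → b ∧ P i) ≡ (if b then count P else 0)
count-const-∧     true  P = refl
count-const-∧ {k} false P = count-false k

count≡∑ : (P : Fin k → Bool) → count P ≡ ∑[ i < k ] indicator (P i)
count≡∑ {zero}  P = refl
count≡∑ {suc k} P = cong (indicator (P zero) +_) (count≡∑ (P ∘ suc))

count-∨-∧ : (P Q : Fin k → Bool) → count (λ i → P i ∨ Q i) + count (λ i → P i ∧ Q i) ≡ count P + count Q
count-∨-∧ {zero}  P Q = refl
count-∨-∧ {suc k} P Q = begin
  (indicator (p ∨ q) + count P∨Q′) + (indicator (p ∧ q) + count P∧Q′)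
    ≡⟨ interchange +-commutativeSemigroup (indicator (p ∨ q)) (count P∨Q′) (indicator (p ∧ q)) (count P∧Q′) ⟩
  (indicator (p ∨ q) + indicator (p ∧ q)) + (count P∨Q′ + count P∧Q′)
    ≡⟨ cong₂ _+_ (indicator-∨-∧ p q) (count-∨-∧ (P ∘ suc) (Q ∘ suc)) ⟩
  (indicator p + indicator q) + (count (P ∘ suc) + count (Q ∘ suc))
    ≡⟨ interchange +-commutativeSemigroup (indicator p) (indicator q) (count (P ∘ suc)) (count (Q ∘ suc)) ⟩
  (indicator p + count (P ∘ suc)) + (indicator q + count (Q ∘ suc))
    ∎
  where
  open ≡-Reasoning
  p = P zero
  q = Q zero
  P∨Q′ = λ i → P (suc i) ∨ Q (suc i)
  P∧Q′ = λ i → P (suc i) ∧ Q (suc i)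
  indicator-∨-∧ : ∀ a b → indicator (a ∨ b) + indicator (a ∧ b) ≡ indicator a + indicator b
  indicator-∨-∧ true  true  = refl
  indicator-∨-∧ true  false = refl
  indicator-∨-∧ false true  = refl
  indicator-∨-∧ false false = refl

count-∨-disjoint : (P Q : Fin k → Bool) → (∀ i → P i ∧ Q i ≡ false) →
                   count (λ i → P i ∨ Q i) ≡ count P + count Q
count-∨-disjoint {k} P Q disjoint = begin
  count (λ i → P i ∨ Q i)                            ≡⟨ +-identityʳ _ ⟨
  count (λ i → P i ∨ Q i) + 0                        ≡⟨ cong (count (λ i → P i ∨ Q i) +_) ∧-count≡0 ⟨
  count (λ i → P i ∨ Q i) + count (λ i → P i ∧ Q i)  ≡⟨ count-∨-∧ P Q ⟩
  count P + count Q                                  ∎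
  where
  open ≡-Reasoning
  ∧-count≡0 : count (λ i → P i ∧ Q i) ≡ 0
  ∧-count≡0 = trans (count-cong disjoint) (count-false k)

∑-if : (P : Fin k → Bool) (x : ℕ) → ∑[ i < k ] (if P i then x else 0) ≡ count P * x
∑-if {zero}  P x = refl
∑-if {suc k} P x with P zero
... | true  = cong (x +_) (∑-if (P ∘ suc) x)
... | false = ∑-if (P ∘ suc) x

∑-δ : (i : Fin k) (f : Fin k → ℕ) → ∑[ j < k ] (if ⌊ i ≟ j ⌋ then f j else 0) ≡ f i
∑-δ {suc k} zero f = trans (cong (f zero +_) (sum-replicate-zero k)) (+-identityʳ _)
∑-δ {suc k} (suc i) f =
  trans (sum-cong-≗ (λ j → cong (λ b → if b then f (suc j) else 0) (≟-suc i j))) (∑-δ i (f ∘ suc))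
  where
  ≟-suc : (i j : Fin k) → ⌊ suc i ≟ suc j ⌋ ≡ ⌊ i ≟ j ⌋
  ≟-suc i j with i ≟ j
  ... | yes _ = refl
  ... | no _  = refl

count-δ : (i : Fin k) (P : Fin k → Bool) → count (λ j → ⌊ i ≟ j ⌋ ∧ P j) ≡ indicator (P i)
count-δ {k} i P = begin
  count (λ j → ⌊ i ≟ j ⌋ ∧ P j)                       ≡⟨ count≡∑ (λ j → ⌊ i ≟ j ⌋ ∧ P j) ⟩
  ∑[ j < k ] indicator (⌊ i ≟ j ⌋ ∧ P j)              ≡⟨ sum-cong-≗ (λ j → indicator-∧ ⌊ i ≟ j ⌋ (P j)) ⟩
  ∑[ j < k ] (if ⌊ i ≟ j ⌋ then indicator (P j) else 0)  ≡⟨ ∑-δ i (indicator ∘ P) ⟩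
  indicator (P i)                                     ∎
  where
  open ≡-Reasoning
  indicator-∧ : ∀ a b → indicator (a ∧ b) ≡ (if a then indicator b else 0)
  indicator-∧ true  b = refl
  indicator-∧ false b = refl

count-++ : ∀ k {l} (P : Fin (k + l) → Bool) → count P ≡ count (λ i → P (i ↑ˡ l)) + count (λ i → P (k ↑ʳ i))
count-++ zero    P = refl
count-++ (suc k) P = trans (cong (indicator (P zero) +_) (count-++ k (P ∘ suc)))
                           (sym (+-assoc (indicator (P zero)) _ _))

count-combine : ∀ m (P : Fin (m * k) → Bool) → count P ≡ ∑[ i < m ] count (λ j → P (combine i j))
count-combine         zero    P = refl
count-combine {k} (suc m) P =
  trans (count-++ k P) (cong (count (λ i → P (i ↑ˡ m * k)) +_) (count-combine m (λ j → P (k ↑ʳ j))))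

count-× : ∀ m (P : Fin m → Bool) (Q : Fin k → Bool) →
          count (λ i → P (quotient k i) ∧ Q (remainder {m} k i)) ≡ count P * count Q
count-× {k} m P Q = begin
  count (P ⊗ Q)                                   ≡⟨ count-combine m (P ⊗ Q) ⟩
  ∑[ i < m ] count (λ j → (P ⊗ Q) (combine i j))  ≡⟨ sum-cong-≗ (λ i → count-cong (⊗-combine i)) ⟩
  ∑[ i < m ] count (λ j → P i ∧ Q j)              ≡⟨ sum-cong-≗ (λ i → count-const-∧ (P i) Q) ⟩
  ∑[ i < m ] (if P i then count Q else 0)         ≡⟨ ∑-if P (count Q) ⟩
  count P * count Q                              ∎
  where
  open ≡-Reasoning
  _⊗_ : (Fin m → Bool) → (Fin k → Bool) → Fin (m * k) → Bool
  (P ⊗ Q) i = P (quotient k i) ∧ Q (remainder {m} k i)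
  ⊗-combine : ∀ i j → (P ⊗ Q) (combine i j) ≡ P i ∧ Q j
  ⊗-combine i j = cong (uncurry λ i′ j′ → P i′ ∧ Q j′) (remQuot-combine i j)

deg≡blackNbrs-all : (X : Graph) (v : Fin (n X)) → deg X v ≡ blackNbrs X (λ _ → true) v
deg≡blackNbrs-all X v = count-cong (λ w → sym (∧-identityʳ (adj X v w)))

blackNbrs-mono : (X : Graph) {c c′ : Colouring X} → c ⊆ c′ → ∀ v → blackNbrs X c v ≤ blackNbrs X c′ v
blackNbrs-mono X {c} {c′} c⊆c′ v = count-mono adj∧-mono
  where
  adj∧-mono : ∀ w → adj X v w ∧ c w ≡ true → adj X v w ∧ c′ w ≡ true
  adj∧-mono w black with adj X v w
  ... | true  = c⊆c′ w black

becomesBlack⁺ : (X : Graph) (c : Colouring X) (v : Fin (n X)) →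
                1 ≤ deg X v → deg X v ≤ 2 * blackNbrs X c v → becomesBlack X c v ≡ true
becomesBlack⁺ X c v 1≤deg deg≤2b with deg X v
... | suc d with ≤? (suc d) (2 * blackNbrs X c v)
...   | yes _     = refl
...   | no  deg≰2b = ⊥-elim (deg≰2b deg≤2b)

becomesBlack⁻ : (X : Graph) (c : Colouring X) (v : Fin (n X)) →
                becomesBlack X c v ≡ true → 1 ≤ deg X v × deg X v ≤ 2 * blackNbrs X c v
becomesBlack⁻ X c v turns with deg X v
... | suc d with ≤? (suc d) (2 * blackNbrs X c v)
...   | yes deg≤2b = s≤s z≤n , deg≤2b

black-persists : (X : Graph) (D : Colouring X) {t t′ : ℕ} {v : Fin (n X)} →
                 t ≤ t′ → process X D t v ≡ true → process X D t′ v ≡ true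
black-persists X D {t′ = zero}   z≤n  black = black
black-persists X D {t′ = suc t′} t≤1+t′ black with m≤n⇒m<n∨m≡n t≤1+t′
... | inj₂ refl      = black
... | inj₁ (s≤s t≤t′) rewrite black-persists X D t≤t′ black = refl

turns-black : (X : Graph) (D : Colouring X) (t : ℕ) {v : Fin (n X)} →
              becomesBlack X (process X D t) v ≡ true → process X D (suc t) v ≡ true
turns-black X D t turns = trans (cong (process X D t _ ∨_) turns) (∨-zeroʳ _)

black-at-suc⁻ : (X : Graph) (D : Colouring X) (t : ℕ) {v : Fin (n X)} → process X D (suc t) v ≡ true →
                process X D t v ≡ true ⊎ becomesBlack X (process X D t) v ≡ true
black-at-suc⁻ X D t {v} black with process X D t v
... | true  = inj₁ refl
... | false = inj₂ black

module _ (G H : Graph) where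

  private
    P = G □ H

  row : Colouring P → Fin (n G) → Colouring H
  row c g h = c (combine g h)

  column : Colouring P → Fin (n H) → Colouring G
  column c h g = c (combine g h)

  □-adj-combine : ∀ g h g′ h′ →
                  adj P (combine g h) (combine g′ h′) ≡ (⌊ g ≟ g′ ⌋ ∧ adj H h h′) ∨ (⌊ h ≟ h′ ⌋ ∧ adj G g g′)
  □-adj-combine g h g′ h′ = cong₂ adjPairs (remQuot-combine g h) (remQuot-combine g′ h′)
    where
    adjPairs : Fin (n G) × Fin (n H) → Fin (n G) × Fin (n H) → Bool
    adjPairs (g , h) (g′ , h′) = (⌊ g ≟ g′ ⌋ ∧ adj H h h′) ∨ (⌊ h ≟ h′ ⌋ ∧ adj G g g′)

  □-blackNbrs-combine : ∀ c g h →
                        blackNbrs P c (combine g h) ≡ blackNbrs H (row c g) h + blackNbrs G (column c h) g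
  □-blackNbrs-combine c g h = begin
    blackNbrs P c (combine g h)
      ≡⟨ count-combine (n G) (λ j → adj P (combine g h) j ∧ c j) ⟩
    ∑[ g′ < n G ] count (λ h′ → adj P (combine g h) (combine g′ h′) ∧ c (combine g′ h′))
      ≡⟨ sum-cong-≗ (λ g′ → trans (count-cong (split g′))
                                  (count-∨-disjoint (inFibreH g′) (inFibreG g′) (disjoint g′))) ⟩
    ∑[ g′ < n G ] (count (inFibreH g′) + count (inFibreG g′))
      ≡⟨ ∑-distrib-+ (λ g′ → count (inFibreH g′)) (λ g′ → count (inFibreG g′)) ⟩
    ∑[ g′ < n G ] count (inFibreH g′) + ∑[ g′ < n G ] count (inFibreG g′)
      ≡⟨ cong₂ _+_ fibreH fibreG ⟩
    blackNbrs H (row c g) h + blackNbrs G (column c h) g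
      ∎
    where
    open ≡-Reasoning
    inFibreH inFibreG : Fin (n G) → Fin (n H) → Bool
    inFibreH g′ h′ = (⌊ g ≟ g′ ⌋ ∧ adj H h h′) ∧ c (combine g′ h′)
    inFibreG g′ h′ = (⌊ h ≟ h′ ⌋ ∧ adj G g g′) ∧ c (combine g′ h′)

    split : ∀ g′ h′ →
            adj P (combine g h) (combine g′ h′) ∧ c (combine g′ h′) ≡ inFibreH g′ h′ ∨ inFibreG g′ h′
    split g′ h′ = trans (cong (_∧ c (combine g′ h′)) (□-adj-combine g h g′ h′))
                        (∧-distribʳ-∨ (c (combine g′ h′)) (⌊ g ≟ g′ ⌋ ∧ adj H h h′) (⌊ h ≟ h′ ⌋ ∧ adj G g g′))

    disjoint : ∀ g′ h′ → inFibreH g′ h′ ∧ inFibreG g′ h′ ≡ false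
    disjoint g′ h′ with g ≟ g′
    ... | no _     = refl
    ... | yes refl rewrite irrefl G g | ∧-zeroʳ ⌊ h ≟ h′ ⌋ = ∧-zeroʳ _

    fibreH : ∑[ g′ < n G ] count (inFibreH g′) ≡ blackNbrs H (row c g) h
    fibreH = begin
      ∑[ g′ < n G ] count (inFibreH g′)
        ≡⟨ sum-cong-≗ (λ g′ → trans (count-cong (λ h′ → ∧-assoc ⌊ g ≟ g′ ⌋ (adj H h h′) (c (combine g′ h′))))
                                  (count-const-∧ ⌊ g ≟ g′ ⌋ (λ h′ → adj H h h′ ∧ row c g′ h′))) ⟩
      ∑[ g′ < n G ] (if ⌊ g ≟ g′ ⌋ then blackNbrs H (row c g′) h else 0)
        ≡⟨ ∑-δ g (λ g′ → blackNbrs H (row c g′) h) ⟩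
      blackNbrs H (row c g) h
        ∎

    fibreG : ∑[ g′ < n G ] count (inFibreG g′) ≡ blackNbrs G (column c h) g
    fibreG = begin
      ∑[ g′ < n G ] count (inFibreG g′)
        ≡⟨ sum-cong-≗ (λ g′ → trans (count-cong (λ h′ → ∧-assoc ⌊ h ≟ h′ ⌋ (adj G g g′) (c (combine g′ h′))))
                                  (count-δ h (λ h′ → adj G g g′ ∧ c (combine g′ h′)))) ⟩
      ∑[ g′ < n G ] indicator (adj G g g′ ∧ column c h g′)
        ≡⟨ count≡∑ (λ g′ → adj G g g′ ∧ column c h g′) ⟨
      blackNbrs G (column c h) g
        ∎

  □-deg-combine : ∀ g h → deg P (combine g h) ≡ deg H h + deg G g
  □-deg-combine g h = begin
    deg P (combine g h)                                   ≡⟨ deg≡blackNbrs-all P (combine g h) ⟩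
    blackNbrs P (λ _ → true) (combine g h)                ≡⟨ □-blackNbrs-combine (λ _ → true) g h ⟩
    blackNbrs H (λ _ → true) h + blackNbrs G (λ _ → true) g
      ≡⟨ cong₂ _+_ (deg≡blackNbrs-all H h) (deg≡blackNbrs-all G g) ⟨
    deg H h + deg G g                                     ∎
    where open ≡-Reasoning

  □-becomesBlack : (c : Colouring P) (cG : Colouring G) (cH : Colouring H) (g : Fin (n G)) (h : Fin (n H)) →
                   cG ⊆ column c h → cH ⊆ row c g →
                   becomesBlack G cG g ≡ true → becomesBlack H cH h ≡ true →
                   becomesBlack P c (combine g h) ≡ true
  □-becomesBlack c cG cH g h cG⊆column cH⊆row turnsG turnsH = becomesBlack⁺ P c (combine g h) 1≤deg deg≤2b
    where
    open ≤-Reasoning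
    thresholdG = becomesBlack⁻ G cG g turnsG
    thresholdH = becomesBlack⁻ H cH h turnsH

    1≤deg : 1 ≤ deg P (combine g h)
    1≤deg = begin
      1                    ≤⟨ proj₁ thresholdG ⟩
      deg G g              ≤⟨ m≤n+m (deg G g) (deg H h) ⟩
      deg H h + deg G g    ≡⟨ □-deg-combine g h ⟨
      deg P (combine g h)  ∎

    deg≤2b : deg P (combine g h) ≤ 2 * blackNbrs P c (combine g h)
    deg≤2b = begin
      deg P (combine g h)
        ≡⟨ □-deg-combine g h ⟩
      deg H h + deg G g
        ≤⟨ +-mono-≤ (proj₂ thresholdH) (proj₂ thresholdG) ⟩
      2 * blackNbrs H cH h + 2 * blackNbrs G cG g
        ≡⟨ *-distribˡ-+ 2 (blackNbrs H cH h) (blackNbrs G cG g) ⟨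
      2 * (blackNbrs H cH h + blackNbrs G cG g)
        ≤⟨ *-monoʳ-≤ 2 (+-mono-≤ (blackNbrs-mono H cH⊆row h) (blackNbrs-mono G cG⊆column g)) ⟩
      2 * (blackNbrs H (row c g) h + blackNbrs G (column c h) g)
        ≡⟨ cong (2 *_) (□-blackNbrs-combine c g h) ⟨
      2 * blackNbrs P c (combine g h)
        ∎

  cross : Colouring G → Colouring H → Colouring P
  cross DG DH i = DG (quotient (n H) i) ∨ DH (remainder {n G} (n H) i)

  cross-combine : (DG : Colouring G) (DH : Colouring H) → ∀ g h → cross DG DH (combine g h) ≡ DG g ∨ DH h
  cross-combine DG DH g h = cong (uncurry λ g′ h′ → DG g′ ∨ DH h′) (remQuot-combine g h)

  module _ (DG : Colouring G) (DH : Colouring H) where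

    private
      pG = process G DG
      pH = process H DH
      pP = process P (cross DG DH)

    cross-black : ∀ s r {g h} → pG s g ≡ true → pH r h ≡ true → pP (s + r) (combine g h) ≡ true
    cross-black zero r {g} {h} g∈DG _ =
      black-persists P (cross DG DH) (z≤n {r}) (trans (cross-combine DG DH g h) (cong (_∨ DH h) g∈DG))
    cross-black (suc s) zero {g} {h} _ h∈DH =
      black-persists P (cross DG DH) (z≤n {suc s + zero})
        (trans (cross-combine DG DH g h) (trans (cong (DG g ∨_) h∈DH) (∨-zeroʳ (DG g))))
    cross-black (suc s) (suc r) {g} {h} blackG blackH
      with black-at-suc⁻ G DG s blackG | black-at-suc⁻ H DH r blackH
    ... | inj₁ earlierG | _ =
      black-persists P (cross DG DH) (n≤1+n (s + suc r)) (cross-black s (suc r) earlierG blackH)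
    ... | inj₂ _ | inj₁ earlierH =
      black-persists P (cross DG DH) (+-monoʳ-≤ (suc s) (n≤1+n r)) (cross-black (suc s) r blackG earlierH)
    ... | inj₂ turnsG | inj₂ turnsH =
      turns-black P (cross DG DH) (s + suc r) (□-becomesBlack (pP (s + suc r)) (pG s) (pH r) g h
        (λ g′ blackG′ → cross-black s (suc r) blackG′ blackH)
        (λ h′ blackH′ → black-persists P (cross DG DH) (≤-reflexive (sym (+-suc s r)))
                                                       (cross-black (suc s) r blackG blackH′))
        turnsG turnsH)

    cross-isDynamo : IsDynamo G DG → IsDynamo H DH → IsDynamo P (cross DG DH)
    cross-isDynamo (tG , allG) (tH , allH) = tG + tH , λ i →
      subst (λ j → pP (tG + tH) j ≡ true) (combine-remQuot {n G} (n H) i) (cross-black tG tH (allG _) (allH _))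

    cross-size : size P (cross DG DH) + size G DG * size H DH ≡ size G DG * n H + n G * size H DH
    cross-size = begin
      count (λ i → A i ∨ B i) + count DG * count DH
        ≡⟨ cong (count (cross DG DH) +_) (count-× (n G) DG DH) ⟨
      count (λ i → A i ∨ B i) + count (λ i → A i ∧ B i)
        ≡⟨ count-∨-∧ A B ⟩
      count A + count B
        ≡⟨ cong₂ _+_ count-A count-B ⟩
      count DG * n H + n G * count DH
        ∎
      where
      open ≡-Reasoning
      A : Fin (n G * n H) → Bool
      A i = DG (quotient (n H) i)
      B : Fin (n G * n H) → Bool
      B i = DH (remainder {n G} (n H) i)
      count-A : count A ≡ count DG * n H
      count-A = begin
        count A                                           ≡⟨ count-cong (λ i → ∧-identityʳ (A i)) ⟨
        count (λ i → A i ∧ true)                          ≡⟨ count-× (n G) DG (λ _ → true) ⟩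
        count DG * count {n H} (λ _ → true)               ≡⟨ cong (count DG *_) (count-true (n H)) ⟩
        count DG * n H                                    ∎
      count-B : count B ≡ n G * count DH
      count-B = begin
        count B                                           ≡⟨ count-× (n G) (λ _ → true) DH ⟩
        count {n G} (λ _ → true) * count DH               ≡⟨ cong (_* count DH) (count-true (n G)) ⟩
        n G * count DH                                    ∎

theorem4 : (G H : Graph) (a b c : ℕ)
    → IsMinDynamoSize G a → IsMinDynamoSize H b → IsMinDynamoSize (G □ H) c
    → c ≤ a * ∣V∣ H + b * ∣V∣ G ∸ a * b
theorem4 G H _ _ c ((DG , DG-dynamo , refl) , _) ((DH , DH-dynamo , refl) , _) (_ , c-minimal) = begin
  c
    ≤⟨ c-minimal D (cross-isDynamo G H DG DH DG-dynamo DH-dynamo) ⟩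
  size (G □ H) D
    ≡⟨ m+n∸n≡m (size (G □ H) D) (count DG * count DH) ⟨
  size (G □ H) D + count DG * count DH ∸ count DG * count DH
    ≡⟨ cong (_∸ count DG * count DH) (cross-size G H DG DH) ⟩
  count DG * n H + n G * count DH ∸ count DG * count DH
    ≡⟨ cong (λ x → count DG * n H + x ∸ count DG * count DH) (*-comm (n G) (count DH)) ⟩
  count DG * n H + count DH * n G ∸ count DG * count DH
    ∎
  where
  open ≤-Reasoning
  D = cross G H DG DH
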